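{- For every game $G$ (writing $k$ for the Nim heap of size $k$): (a) $G+n$ is not of type $\mathcal P$ for $n\ge 2$; (b) $G+n$ is not of type $\mathcal O$ for $n\ge 3$; (c) if $G+m$ is of type $\mathcal N$ then $G+n$ is of type $\mathcal N$, for $m,n\ge 2$; (d) $G+1+n$ is not of type $\mathcal O$ for $n\ge 2$; (e) $G+m+n$ is not of type $\mathcal N$ for $m,n\ge 2$; (f) $G+m+n$ is not of type $\mathcal O$ for $m,n\ge 2$; (g) $G+m+n$ is not of type $\mathcal P$ for $m,n\ge 2$.
   Context: A (finite impartial) game is defined recursively as a finite set of games, its options; $0$ is the game with no options. Three players alternate moves cyclically; a move replaces the current game by one of its options, and the player who makes the last move wins. The disjunctive sum $G+H$ is the game whose options are all $G'+H$ and all $G+H'$. Types are defined recursively: $G$ is of type $\mathcal N$ iff it has some option of type $\mathcal P$; of type $\mathcal O$ iff it has at least one option and all its options are of type $\mathcal N$; of type $\mathcal P$ iff all its options are of type $\mathcal O$; of type $\mathcal Q$ otherwise. The Nim heap of size $n$ is the game whose options are the heaps of sizes $0,1,\dots,n-1$. -}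

module Defs where

open import Data.Nat using (ℕ; zero; suc)
open import Data.List using (List; []; _∷_; _++_; _∷ʳ_)
open import Data.Bool using (Bool; true; false; _∧_; _∨_; not)

-- A finite impartial game, given by its (finite) list of options.
-- Order and repetition of options are irrelevant for everything below.
data Game : Set where
  node : List Game → Game

options : Game → List Game
options (node gs) = gs

data Ty : Set where
  𝒩 𝒪 𝒫 𝒬 : Ty

isN isO isP : Ty → Bool
isN 𝒩 = true
isN _ = false
isO 𝒪 = true
isO _ = false
isP 𝒫 = true
isP _ = false

anyB allB : (Ty → Bool) → List Ty → Bool
anyB p [] = false
anyB p (t ∷ ts) = p t ∨ anyB p ts
allB p [] = true
allB p (t ∷ ts) = p t ∧ allB p ts

nonEmpty : List Ty → Bool
nonEmpty [] = false
nonEmpty (_ ∷ _) = true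

classify : List Ty → Ty
classify ts with anyB isP ts
... | true = 𝒩
... | false with nonEmpty ts ∧ allB isN ts
...   | true = 𝒪
...   | false with allB isO ts
...     | true = 𝒫
...     | false = 𝒬

mutual
  type : Game → Ty
  type (node gs) = classify (types gs)

  types : List Game → List Ty
  types [] = []
  types (g ∷ gs) = type g ∷ types gs

mutual
  infixl 6 _+_
  _+_ : Game → Game → Game
  G@(node gs) + H@(node hs) = node (leftOpts gs H ++ rightOpts G hs)

  leftOpts : List Game → Game → List Game
  leftOpts [] H = []
  leftOpts (g ∷ gs) H = (g + H) ∷ leftOpts gs H

  rightOpts : Game → List Game → List Game
  rightOpts G [] = []
  rightOpts G (h ∷ hs) = (G + h) ∷ rightOpts G hs

-- heaps n = list of Nim heaps of sizes 0, 1, ..., n-1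
heaps : ℕ → List Game
heaps zero = []
heaps (suc n) = heaps n ∷ʳ node (heaps n)

nim : ℕ → Game
nim n = node (heaps n)

{-# OPTIONS --safe #-}
-- The options of G + n are the games x + n for options x of G and the G + k for k < n, and
-- G + 0 = G. Since G is an option of G + 1, the options G and G + 1 of G + n (n ≥ 2) are never
-- both 𝒪, which is (a). By (a), an option of G + m (m ≥ 2) can only be 𝒫 if it is G or G + 1,
-- and both are options of every G + n with n ≥ 2: this is (c). For n ≥ 3 the option G + 2 of
-- an 𝒪-position G + n would be 𝒩, so G + n would be 𝒩 by (c); this is (b).
module Submission where

open import Defs
open import Data.Bool using (Bool; true; false; T; _∧_)
open import Data.Bool.Properties using (T-≡; T-∧; T-∨)
open import Data.List using (List; []; _∷_; _++_; _∷ʳ_; map; applyUpTo)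
open import Data.List.Properties using (++-identityʳ; applyUpTo-∷ʳ)
open import Data.List.Membership.Propositional using (_∈_; _∉_)
open import Data.List.Membership.Propositional.Properties
  using (∈-++⁺ˡ; ∈-++⁺ʳ; ∈-++⁻; ∈-map⁺; ∈-map⁻; ∈-applyUpTo⁺; ∈-applyUpTo⁻)
open import Data.List.Relation.Unary.All as All using (All; []; _∷_)
import Data.List.Relation.Unary.All.Properties as All
open import Data.List.Relation.Unary.Any using (Any; here; there)
open import Data.Nat using (zero; suc; _≤_; _<_; z≤n; s≤s; z<s; s<s)
open import Data.Nat.Properties using (<-trans; ≤-refl; <⇒≤)
open import Data.Product using (_×_; ∃; _,_; proj₂)
open import Data.Sum using (_⊎_; inj₁; inj₂; [_,_])
open import Function using (_∘_; case_of_)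
open import Function.Bundles using (Equivalence)
open import Relation.Binary.PropositionalEquality using (_≡_; _≢_; refl; sym; trans; cong; cong₂; subst)
open import Relation.Nullary.Negation using (contradiction)

open Equivalence using (to; from)

module _ (p : Ty → Bool) {P : Ty → Set} where

  anyB⇒Any : (∀ {t} → T (p t) → P t) → ∀ ts → T (anyB p ts) → Any P ts
  anyB⇒Any sound (t ∷ ts) h = [ here ∘ sound , there ∘ anyB⇒Any sound ts ] (T-∨ .to h)

  Any⇒anyB : (∀ {t} → P t → T (p t)) → ∀ {ts} → Any P ts → T (anyB p ts)
  Any⇒anyB complete (here pt) = T-∨ .from (inj₁ (complete pt))
  Any⇒anyB complete (there a) = T-∨ .from (inj₂ (Any⇒anyB complete a))

  allB⇒All : (∀ {t} → T (p t) → P t) → ∀ ts → T (allB p ts) → All P ts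
  allB⇒All sound []       _ = []
  allB⇒All sound (t ∷ ts) h with pt , pts ← T-∧ .to h = sound pt ∷ allB⇒All sound ts pts

isP-sound : ∀ {t} → T (isP t) → 𝒫 ≡ t
isP-sound {𝒫} _ = refl

isP-complete : ∀ {t} → 𝒫 ≡ t → T (isP t)
isP-complete refl = _

isN-sound : ∀ {t} → T (isN t) → t ≡ 𝒩
isN-sound {𝒩} _ = refl

isO-sound : ∀ {t} → T (isO t) → t ≡ 𝒪
isO-sound {𝒪} _ = refl

data Classified (ts : List Ty) : Ty → Set where
  some-𝒫 : 𝒫 ∈ ts → Classified ts 𝒩
  all-𝒩  : All (_≡ 𝒩) ts → Classified ts 𝒪
  all-𝒪  : All (_≡ 𝒪) ts → Classified ts 𝒫
  no-𝒫   : 𝒫 ∉ ts → Classified ts 𝒬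

classified : ∀ ts → Classified ts (classify ts)
classified ts with anyB isP ts in some
... | true = some-𝒫 (anyB⇒Any isP isP-sound ts (T-≡ .from some))
... | false with nonEmpty ts ∧ allB isN ts in nonEmpty-allN
...   | true =
  all-𝒩 (allB⇒All isN isN-sound ts (proj₂ (T-∧ {nonEmpty ts} .to (T-≡ .from nonEmpty-allN))))
...   | false with allB isO ts in allO
...     | true  = all-𝒪 (allB⇒All isO isO-sound ts (T-≡ .from allO))
...     | false = no-𝒫 (λ 𝒫∈ → subst T some (Any⇒anyB isP isP-complete 𝒫∈))

-- A record rather than a synonym for z ∈ options G, so that G can be inferred.
record _◁_ (z G : Game) : Set where
  constructor option
  field member : z ∈ options G

infix 4 _◁_

types≡map-type : ∀ gs → types gs ≡ map type gs
types≡map-type []       = refl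
types≡map-type (g ∷ gs) = cong (type g ∷_) (types≡map-type gs)

classifiedOptions : ∀ G → Classified (map type (options G)) (type G)
classifiedOptions (node gs) =
  subst (λ ts → Classified ts (classify (types gs))) (types≡map-type gs) (classified (types gs))

classifiedAs : ∀ G {t} → type G ≡ t → Classified (map type (options G)) t
classifiedAs G refl = classifiedOptions G

𝒫⇒option-𝒪 : ∀ {G z} → type G ≡ 𝒫 → z ◁ G → type z ≡ 𝒪
𝒫⇒option-𝒪 {G} G-𝒫 (option z∈) with all-𝒪 os ← classifiedAs G G-𝒫 = All.lookup (All.map⁻ os) z∈

𝒪⇒option-𝒩 : ∀ {G z} → type G ≡ 𝒪 → z ◁ G → type z ≡ 𝒩
𝒪⇒option-𝒩 {G} G-𝒪 (option z∈) with all-𝒩 ns ← classifiedAs G G-𝒪 = All.lookup (All.map⁻ ns) z∈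

-- type (node []) computes to 𝒫, so only nonempty option lists need a clause.
𝒪⇒has-option : ∀ {G} → type G ≡ 𝒪 → ∃ (_◁ G)
𝒪⇒has-option {node (g ∷ _)} _ = g , option (here refl)

𝒩⇒𝒫-option : ∀ {G} → type G ≡ 𝒩 → ∃ λ z → z ◁ G × type z ≡ 𝒫
𝒩⇒𝒫-option {G} G-𝒩 with some-𝒫 𝒫∈ ← classifiedAs G G-𝒩 with z , z∈ , 𝒫≡ ← ∈-map⁻ type 𝒫∈ =
  z , option z∈ , sym 𝒫≡

options-≢𝒫⇒≢𝒩 : ∀ {G} → (∀ {z} → z ◁ G → type z ≢ 𝒫) → type G ≢ 𝒩
options-≢𝒫⇒≢𝒩 options-≢𝒫 G-𝒩 with z , z◁ , z-𝒫 ← 𝒩⇒𝒫-option G-𝒩 = options-≢𝒫 z◁ z-𝒫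

𝒫-option⇒𝒩 : ∀ {G z} → z ◁ G → type z ≡ 𝒫 → type G ≡ 𝒩
𝒫-option⇒𝒩 {G} (option z∈) z-𝒫 with type G | classifiedOptions G
... | 𝒩 | _         = refl
... | 𝒪 | all-𝒩 ns = case trans (sym z-𝒫) (All.lookup (All.map⁻ ns) z∈) of λ ()
... | 𝒫 | all-𝒪 os = case trans (sym z-𝒫) (All.lookup (All.map⁻ os) z∈) of λ ()
... | 𝒬 | no-𝒫 𝒫∉  = contradiction (subst (_∈ _) z-𝒫 (∈-map⁺ type z∈)) 𝒫∉

leftOpts≡map : ∀ gs H → leftOpts gs H ≡ map (_+ H) gs
leftOpts≡map []       H = refl
leftOpts≡map (g ∷ gs) H = cong (g + H ∷_) (leftOpts≡map gs H)

rightOpts≡map : ∀ G hs → rightOpts G hs ≡ map (G +_) hs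
rightOpts≡map G []       = refl
rightOpts≡map G (h ∷ hs) = cong (G + h ∷_) (rightOpts≡map G hs)

options-+ : ∀ G H → options (G + H) ≡ map (_+ H) (options G) ++ map (G +_) (options H)
options-+ G@(node gs) H@(node hs) = cong₂ _++_ (leftOpts≡map gs H) (rightOpts≡map G hs)

+-monoˡ-◁ : ∀ {x G} H → x ◁ G → x + H ◁ G + H
+-monoˡ-◁ {G = G} H (option x∈) =
  option (subst (_ ∈_) (sym (options-+ G H)) (∈-++⁺ˡ (∈-map⁺ (_+ H) x∈)))

+-monoʳ-◁ : ∀ G {y H} → y ◁ H → G + y ◁ G + H
+-monoʳ-◁ G {H = H} (option y∈) =
  option (subst (_ ∈_) (sym (options-+ G H)) (∈-++⁺ʳ (map (_+ H) (options G)) (∈-map⁺ (G +_) y∈)))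

◁-+⁻ : ∀ {z} G H → z ◁ G + H →
       (∃ λ x → x ◁ G × z ≡ x + H) ⊎ (∃ λ y → y ◁ H × z ≡ G + y)
◁-+⁻ G H (option z∈) with ∈-++⁻ (map (_+ H) (options G)) (subst (_ ∈_) (options-+ G H) z∈)
... | inj₁ z∈ˡ with x , x∈ , refl ← ∈-map⁻ (_+ H) z∈ˡ = inj₁ (x , option x∈ , refl)
... | inj₂ z∈ʳ with y , y∈ , refl ← ∈-map⁻ (G +_) z∈ʳ = inj₂ (y , option y∈ , refl)

mutual
  +-identityʳ : ∀ G → G + nim 0 ≡ G
  +-identityʳ (node gs) = cong node (trans (++-identityʳ _) (leftOpts-identityʳ gs))

  leftOpts-identityʳ : ∀ gs → leftOpts gs (nim 0) ≡ gs
  leftOpts-identityʳ []       = refl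
  leftOpts-identityʳ (g ∷ gs) = cong₂ _∷_ (+-identityʳ g) (leftOpts-identityʳ gs)

heaps≡applyUpTo : ∀ n → heaps n ≡ applyUpTo nim n
heaps≡applyUpTo zero    = refl
heaps≡applyUpTo (suc n) = trans (cong (_∷ʳ nim n) (heaps≡applyUpTo n)) (applyUpTo-∷ʳ nim n)

nim-◁-nim : ∀ {k n} → k < n → nim k ◁ nim n
nim-◁-nim {n = n} k<n = option (subst (_ ∈_) (sym (heaps≡applyUpTo n)) (∈-applyUpTo⁺ nim k<n))

◁-nim⁻ : ∀ {z} n → z ◁ nim n → ∃ λ k → k < n × z ≡ nim k
◁-nim⁻ n (option z∈) = ∈-applyUpTo⁻ nim (subst (_ ∈_) (heaps≡applyUpTo n) z∈)

+nim-◁ : ∀ G {k n} → k < n → G + nim k ◁ G + nim n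
+nim-◁ G k<n = +-monoʳ-◁ G (nim-◁-nim k<n)

◁-+nim : ∀ G {n} → 0 < n → G ◁ G + nim n
◁-+nim G {n} 0<n = subst (_◁ G + nim n) (+-identityʳ G) (+nim-◁ G 0<n)

◁-+nim⁻ : ∀ {z} G n → z ◁ G + nim n →
          (∃ λ x → x ◁ G × z ≡ x + nim n) ⊎ (∃ λ k → k < n × z ≡ G + nim k)
◁-+nim⁻ G n z◁ with ◁-+⁻ G (nim n) z◁
... | inj₁ left = inj₁ left
... | inj₂ (_ , y◁ , refl) with k , k<n , refl ← ◁-nim⁻ n y◁ = inj₂ (k , k<n , refl)

◁-+nim1⁻ : ∀ {z} G → z ◁ G + nim 1 → z ≡ G ⊎ ∃ λ x → x ◁ G × z ≡ x + nim 1
◁-+nim1⁻ G z◁ with ◁-+nim⁻ G 1 z◁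
... | inj₁ left                = inj₂ left
... | inj₂ (0 , _ , refl)      = inj₁ (+-identityʳ G)
... | inj₂ (suc _ , s≤s () , _)

type-+nim≢𝒫 : ∀ G n → 2 ≤ n → type (G + nim n) ≢ 𝒫
type-+nim≢𝒫 G n 2≤n Gn-𝒫 = case trans (sym G-𝒪) G-𝒩 of λ ()
  where
  G-𝒪 : type G ≡ 𝒪
  G-𝒪 = 𝒫⇒option-𝒪 Gn-𝒫 (◁-+nim G (<-trans z<s 2≤n))
  G-𝒩 : type G ≡ 𝒩
  G-𝒩 = 𝒪⇒option-𝒩 (𝒫⇒option-𝒪 Gn-𝒫 (+nim-◁ G 2≤n)) (◁-+nim G {1} z<s)

+nim-𝒩⇒small-𝒫 : ∀ G m → 2 ≤ m → type (G + nim m) ≡ 𝒩 →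
                 type G ≡ 𝒫 ⊎ type (G + nim 1) ≡ 𝒫
+nim-𝒩⇒small-𝒫 G m 2≤m Gm-𝒩 with z , z◁ , z-𝒫 ← 𝒩⇒𝒫-option Gm-𝒩 with ◁-+nim⁻ G m z◁
... | inj₁ (x , _ , refl)              = contradiction z-𝒫 (type-+nim≢𝒫 x m 2≤m)
... | inj₂ (0 , _ , refl)              = inj₁ (trans (sym (cong type (+-identityʳ G))) z-𝒫)
... | inj₂ (1 , _ , refl)              = inj₂ z-𝒫
... | inj₂ (k@(suc (suc _)) , _ , refl) = contradiction z-𝒫 (type-+nim≢𝒫 G k (s≤s (s≤s z≤n)))

small-𝒫⇒+nim-𝒩 : ∀ G n → 2 ≤ n → type G ≡ 𝒫 ⊎ type (G + nim 1) ≡ 𝒫 →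
                 type (G + nim n) ≡ 𝒩
small-𝒫⇒+nim-𝒩 G n 2≤n =
  [ 𝒫-option⇒𝒩 (◁-+nim G (<-trans z<s 2≤n)) , 𝒫-option⇒𝒩 (+nim-◁ G 2≤n) ]

+nim-𝒩-transfer : ∀ G m n → 2 ≤ m → 2 ≤ n → type (G + nim m) ≡ 𝒩 → type (G + nim n) ≡ 𝒩
+nim-𝒩-transfer G m n 2≤m 2≤n = small-𝒫⇒+nim-𝒩 G n 2≤n ∘ +nim-𝒩⇒small-𝒫 G m 2≤m

type-+nim≢𝒪 : ∀ G n → 3 ≤ n → type (G + nim n) ≢ 𝒪
type-+nim≢𝒪 G n 3≤n Gn-𝒪 = case trans (sym Gn-𝒪) Gn-𝒩 of λ ()
  where
  Gn-𝒩 : type (G + nim n) ≡ 𝒩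
  Gn-𝒩 = +nim-𝒩-transfer G 2 n ≤-refl (<⇒≤ 3≤n) (𝒪⇒option-𝒩 Gn-𝒪 (+nim-◁ G 3≤n))

𝒩⇒+nim≢𝒩 : ∀ G n → 2 ≤ n → type G ≡ 𝒩 → type (G + nim n) ≢ 𝒩
𝒩⇒+nim≢𝒩 G n 2≤n G-𝒩 Gn-𝒩 with +nim-𝒩⇒small-𝒫 G n 2≤n Gn-𝒩
... | inj₁ G-𝒫  = case trans (sym G-𝒫) G-𝒩 of λ ()
... | inj₂ G1-𝒫 = case trans (sym (𝒫⇒option-𝒪 G1-𝒫 (◁-+nim G {1} z<s))) G-𝒩 of λ ()

𝒫⇒+nim1+nim1≢𝒩 : ∀ G → type G ≡ 𝒫 → type (G + nim 1 + nim 1) ≢ 𝒩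
𝒫⇒+nim1+nim1≢𝒩 G G-𝒫 = options-≢𝒫⇒≢𝒩 options-≢𝒫
  where
  G1-𝒩 : type (G + nim 1) ≡ 𝒩
  G1-𝒩 = 𝒫-option⇒𝒩 (◁-+nim G {1} z<s) G-𝒫

  options-≢𝒫 : ∀ {z} → z ◁ G + nim 1 + nim 1 → type z ≢ 𝒫
  options-≢𝒫 z◁ z-𝒫 with ◁-+nim1⁻ (G + nim 1) z◁
  ... | inj₁ refl = case trans (sym z-𝒫) G1-𝒩 of λ ()
  ... | inj₂ (_ , x◁ , refl) with ◁-+nim1⁻ G x◁
  ...   | inj₁ refl = case trans (sym z-𝒫) G1-𝒩 of λ ()
  ...   | inj₂ (g , g◁ , refl) = case trans (sym (𝒫⇒option-𝒪 G-𝒫 g◁)) g-𝒩 of λ ()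
    where
    g-𝒩 : type g ≡ 𝒩
    g-𝒩 = 𝒪⇒option-𝒩 (𝒫⇒option-𝒪 z-𝒫 (◁-+nim (g + nim 1) {1} z<s)) (◁-+nim g {1} z<s)

type-+nim1+nim2≢𝒪 : ∀ G → type (G + nim 1 + nim 2) ≢ 𝒪
type-+nim1+nim2≢𝒪 G G12-𝒪 = 𝒫⇒+nim1+nim1≢𝒩 G G-𝒫 G11-𝒩
  where
  G11-𝒩 : type (G + nim 1 + nim 1) ≡ 𝒩
  G11-𝒩 = 𝒪⇒option-𝒩 G12-𝒪 (+nim-◁ (G + nim 1) {1} {2} (s<s z<s))
  G1-𝒩 : type (G + nim 1) ≡ 𝒩
  G1-𝒩 = 𝒪⇒option-𝒩 G12-𝒪 (◁-+nim (G + nim 1) {2} z<s)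
  G2-𝒩 : type (G + nim 2) ≡ 𝒩
  G2-𝒩 = 𝒪⇒option-𝒩 G12-𝒪 (+-monoˡ-◁ (nim 2) (◁-+nim G {1} z<s))
  G-𝒫 : type G ≡ 𝒫
  G-𝒫 with +nim-𝒩⇒small-𝒫 G 2 ≤-refl G2-𝒩
  ... | inj₁ G-𝒫  = G-𝒫
  ... | inj₂ G1-𝒫 = case trans (sym G1-𝒫) G1-𝒩 of λ ()

type-+nim1+nim≢𝒪 : ∀ G n → 2 ≤ n → type (G + nim 1 + nim n) ≢ 𝒪
type-+nim1+nim≢𝒪 G 1                     (s≤s ())
type-+nim1+nim≢𝒪 G 2                     _ = type-+nim1+nim2≢𝒪 G
type-+nim1+nim≢𝒪 G n@(suc (suc (suc _))) _ = type-+nim≢𝒪 (G + nim 1) n (s≤s (s≤s (s≤s z≤n)))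

type-+nim+nim≢𝒫 : ∀ G m k → 2 ≤ m → type (G + nim m + nim k) ≢ 𝒫
type-+nim+nim≢𝒫 G m 0 2≤m = type-+nim≢𝒫 G m 2≤m ∘ trans (sym (cong type (+-identityʳ (G + nim m))))
type-+nim+nim≢𝒫 G m 1 2≤m Gm1-𝒫 = case trans (sym G1-𝒪) G1-𝒩 of λ ()
  where
  G1-𝒪 : type (G + nim 1) ≡ 𝒪
  G1-𝒪 = 𝒫⇒option-𝒪 Gm1-𝒫 (+-monoˡ-◁ (nim 1) (◁-+nim G (<-trans z<s 2≤m)))
  G1-𝒩 : type (G + nim 1) ≡ 𝒩
  G1-𝒩 = 𝒪⇒option-𝒩 (𝒫⇒option-𝒪 Gm1-𝒫 (◁-+nim (G + nim m) {1} z<s)) (+nim-◁ G 2≤m)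
type-+nim+nim≢𝒫 G m k@(suc (suc _)) _ = type-+nim≢𝒫 (G + nim m) k (s≤s (s≤s z≤n))

type-+nim+nim≢𝒩 : ∀ G m n → 2 ≤ m → 2 ≤ n → type (G + nim m + nim n) ≢ 𝒩
type-+nim+nim≢𝒩 G m n 2≤m 2≤n = options-≢𝒫⇒≢𝒩 options-≢𝒫
  where
  options-≢𝒫 : ∀ {z} → z ◁ G + nim m + nim n → type z ≢ 𝒫
  options-≢𝒫 z◁ with ◁-+nim⁻ (G + nim m) n z◁
  ... | inj₁ (x , _ , refl) = type-+nim≢𝒫 x n 2≤n
  ... | inj₂ (k , _ , refl) = type-+nim+nim≢𝒫 G m k 2≤m

type-+nim+nim2≢𝒪 : ∀ G m → 2 ≤ m → type (G + nim m + nim 2) ≢ 𝒪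
type-+nim+nim2≢𝒪 G m 2≤m Gm2-𝒪 = [ G-≢𝒫 , G1-≢𝒫 ] (+nim-𝒩⇒small-𝒫 G m 2≤m Gm-𝒩)
  where
  Gm-𝒩 : type (G + nim m) ≡ 𝒩
  Gm-𝒩 = 𝒪⇒option-𝒩 Gm2-𝒪 (◁-+nim (G + nim m) {2} z<s)

  G-≢𝒫 : type G ≢ 𝒫
  G-≢𝒫 G-𝒫 = 𝒩⇒+nim≢𝒩 (G + nim 1) 2 ≤-refl G1-𝒩 G12-𝒩
    where
    G1-𝒩 : type (G + nim 1) ≡ 𝒩
    G1-𝒩 = 𝒫-option⇒𝒩 (◁-+nim G {1} z<s) G-𝒫
    G12-𝒩 : type (G + nim 1 + nim 2) ≡ 𝒩
    G12-𝒩 = 𝒪⇒option-𝒩 Gm2-𝒪 (+-monoˡ-◁ (nim 2) (+nim-◁ G 2≤m))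

  G1-≢𝒫 : type (G + nim 1) ≢ 𝒫
  G1-≢𝒫 G1-𝒫 with g , g◁ ← 𝒪⇒has-option {G} (𝒫⇒option-𝒪 G1-𝒫 (◁-+nim G {1} z<s)) =
    type-+nim+nim≢𝒩 g m 2 2≤m ≤-refl (𝒪⇒option-𝒩 Gm2-𝒪 (+-monoˡ-◁ (nim 2) (+-monoˡ-◁ (nim m) g◁)))

type-+nim+nim≢𝒪 : ∀ G m n → 2 ≤ m → 2 ≤ n → type (G + nim m + nim n) ≢ 𝒪
type-+nim+nim≢𝒪 G m 1                     _   (s≤s ())
type-+nim+nim≢𝒪 G m 2                     2≤m _ = type-+nim+nim2≢𝒪 G m 2≤m
type-+nim+nim≢𝒪 G m n@(suc (suc (suc _))) _   _ = type-+nim≢𝒪 (G + nim m) n (s≤s (s≤s (s≤s z≤n)))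

claim11 : (G : Game) →
    (∀ n → 2 ≤ n → type (G + nim n) ≢ 𝒫)
    × (∀ n → 3 ≤ n → type (G + nim n) ≢ 𝒪)
    × (∀ m n → 2 ≤ m → 2 ≤ n → type (G + nim m) ≡ 𝒩 → type (G + nim n) ≡ 𝒩)
    × (∀ n → 2 ≤ n → type (G + nim 1 + nim n) ≢ 𝒪)
    × (∀ m n → 2 ≤ m → 2 ≤ n → type (G + nim m + nim n) ≢ 𝒩)
    × (∀ m n → 2 ≤ m → 2 ≤ n → type (G + nim m + nim n) ≢ 𝒪)
    × (∀ m n → 2 ≤ m → 2 ≤ n → type (G + nim m + nim n) ≢ 𝒫)
claim11 G =
    type-+nim≢𝒫 G
  , type-+nim≢𝒪 G
  , +nim-𝒩-transfer G
  , type-+nim1+nim≢𝒪 G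
  , type-+nim+nim≢𝒩 G
  , type-+nim+nim≢𝒪 G
  , λ m n 2≤m _ → type-+nim+nim≢𝒫 G m n 2≤m
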